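{- For any graded derivation $f$ of $M_\mu$ (a derivation of the Lie algebra $M_\mu$ with $f(V_\mu)\subseteq V_\mu$), the map $\sigma_f:N\to N$ defined by $\sigma_f((a,u))=(a,u+f(a))$ for $(a,u)\in S$ and $\sigma_f(b)=b$ for $b\in Q$ is an automorphism of the structure $N$ (fixing $Q$ pointwise).
   Context: Fix a finite field $\mathbb{F}_q$, $q>2$, and let $M_\mu=V_\mu\oplus\bigwedge^2V_\mu/N(V_\mu)$ be Baudisch's uncountably categorical $2$-nilpotent graded $\mathbb{F}_q$-Lie algebra (for a good map $\mu$), viewed in the language $L$ of $\mathbb{F}_q$-vector spaces with the Lie bracket and unary predicates for the degree-one part $V_\mu$ and degree-two part. The two-sorted structure $N$: the sort $Q$ is $M_\mu$ with its full $L$-structure; $P=V_\mu$; the sort $S$ is the set $V_\mu^2$ equipped with the projection $\pi:S\to P$, $\pi((a,u))=a$; the action $P\times S\to S$, $b*(a,u)=(a,u+b)$; the group law $+$ on $S$ (coordinatewise addition); and for each $n\ge1$ and $W=\{(\bar x,\bar y)\in V_\mu^{2n}:\sum_{i<n}[x_i,y_i]=0\}$ a relation $T_W$ on $S^{2n}$ consisting of tuples $((x_i,u_i)_{i<n},(y_i,v_i)_{i<n})$ with $\sum_{i<n}[x_i,y_i]=0$ and $\sum_{i<n}([u_i,y_i]+[x_i,v_i])=0$. -}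

module Defs where

open import Data.Nat using (ℕ; zero; suc; _<_)
open import Data.Fin using (Fin)
import Data.Fin as Fin
open import Data.Product using (Σ; _×_; _,_; proj₁; proj₂)
open import Relation.Binary.PropositionalEquality using (_≡_)
open import Relation.Nullary using (¬_)
open import Function using (_∘_)
open import Function.Bundles using (_↔_; _⇔_)
open import Function.Definitions using (Bijective)
open import Algebra.Structures using (IsCommutativeRing; IsAbelianGroup)

record FiniteField : Set₁ where
  field
    K       : Set
    _+K_    : K → K → K
    _*K_    : K → K → K
    -K_     : K → K
    0K 1K   : K
    isCommutativeRing : IsCommutativeRing _≡_ _+K_ _*K_ -K_ 0K 1K
    0≢1     : ¬ (0K ≡ 1K)
    inverse : ∀ x → ¬ (x ≡ 0K) → Σ K (λ y → x *K y ≡ 1K)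
    q       : ℕ
    2<q     : 2 < q
    enum    : K ↔ Fin q

record VectorSpace (F : FiniteField) : Set₁ where
  open FiniteField F
  infixl 6 _+_
  infixr 7 _·_
  field
    C    : Set
    _+_  : C → C → C
    0v   : C
    -_   : C → C
    _·_  : K → C → C
    isAbelianGroup : IsAbelianGroup _≡_ _+_ 0v -_
    ·-distribˡ : ∀ k u v → k · (u + v) ≡ k · u + k · v
    ·-distribʳ : ∀ k l u → (k +K l) · u ≡ k · u + l · u
    ·-assoc    : ∀ k l u → (k *K l) · u ≡ k · (l · u)
    ·-identity : ∀ u → 1K · u ≡ u

-- A 2-nilpotent graded Lie algebra M = V ⊕ D over F:
-- degree-one part V, degree-two part D, bracket [V,V] ⊆ D, [M,D] = 0.
-- It is given by an alternating bilinear map β : V × V → D.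

record TwoNilGradedLie (F : FiniteField) : Set₁ where
  open FiniteField F
  field
    V : VectorSpace F
    D : VectorSpace F
  module V = VectorSpace V
  module D = VectorSpace D
  field
    β        : V.C → V.C → D.C
    β-+ˡ     : ∀ a b c → β (a V.+ b) c ≡ β a c D.+ β b c
    β-+ʳ     : ∀ a b c → β a (b V.+ c) ≡ β a b D.+ β a c
    β-·ˡ     : ∀ k a b → β (k V.· a) b ≡ k D.· β a b
    β-·ʳ     : ∀ k a b → β a (k V.· b) ≡ k D.· β a b
    β-alt    : ∀ a → β a a ≡ D.0v

module _ {F : FiniteField} (L : TwoNilGradedLie F) where
  open FiniteField F
  open TwoNilGradedLie L

  M : Set
  M = V.C × D.C

  0M : M
  0M = V.0v , D.0v

  _+M_ : M → M → M
  (a , x) +M (b , y) = (a V.+ b) , (x D.+ y)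

  -M_ : M → M
  -M (a , x) = (V.- a) , (D.- x)

  _·M_ : K → M → M
  k ·M (a , x) = (k V.· a) , (k D.· x)

  ⟦_,_⟧ : M → M → M
  ⟦ (a , x) , (b , y) ⟧ = V.0v , β a b

  InV : M → Set
  InV (a , x) = x ≡ D.0v

  InD : M → Set
  InD (a , x) = a ≡ V.0v

  ι : V.C → M
  ι a = a , D.0v

  record IsGradedDerivation (f : M → M) : Set where
    field
      additive    : ∀ m n → f (m +M n) ≡ f m +M f n
      homogeneous : ∀ k m → f (k ·M m) ≡ k ·M f m
      leibniz     : ∀ m n → f ⟦ m , n ⟧ ≡ ⟦ f m , n ⟧ +M ⟦ m , f n ⟧
      graded      : ∀ a → InV (f (ι a))

  fV : (M → M) → V.C → V.C
  fV f a = proj₁ (f (ι a))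

  -- The two-sorted structure N.
  -- Sort Q = M (with the L-structure above); P = V (the predicate InV);
  -- sort S = V × V.

  S : Set
  S = V.C × V.C

  π : S → M
  π (a , u) = ι a

  -- graph of the action P × S → S, b * (a , u) = (a , u + b)
  Act : M → S → S → Set
  Act b (a , u) t = InV b × (t ≡ (a , (u V.+ proj₁ b)))

  _+S_ : S → S → S
  (a , u) +S (b , v) = (a V.+ b) , (u V.+ v)

  sumM : (n : ℕ) → (Fin n → M) → M
  sumM zero    g = 0M
  sumM (suc n) g = g Fin.zero +M sumM n (g ∘ Fin.suc)

  T : (n : ℕ) → (Fin n → S) → (Fin n → S) → Set
  T n xs ys =
    (sumM n (λ i → ⟦ ι (proj₁ (xs i)) , ι (proj₁ (ys i)) ⟧) ≡ 0M)
    × (sumM n (λ i → ⟦ ι (proj₂ (xs i)) , ι (proj₁ (ys i)) ⟧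
                  +M ⟦ ι (proj₁ (xs i)) , ι (proj₂ (ys i)) ⟧) ≡ 0M)

  record IsAutomorphismN (σQ : M → M) (σS : S → S) : Set where
    field
      bijQ   : Bijective _≡_ _≡_ σQ
      bijS   : Bijective _≡_ _≡_ σS
      pres-0   : σQ 0M ≡ 0M
      pres-+   : ∀ m n → σQ (m +M n) ≡ σQ m +M σQ n
      pres--   : ∀ m → σQ (-M m) ≡ -M (σQ m)
      pres-·   : ∀ k m → σQ (k ·M m) ≡ k ·M σQ m
      pres-br  : ∀ m n → σQ ⟦ m , n ⟧ ≡ ⟦ σQ m , σQ n ⟧
      pres-V   : ∀ m → InV m ⇔ InV (σQ m)
      pres-D   : ∀ m → InD m ⇔ InD (σQ m)
      pres-π   : ∀ s → σQ (π s) ≡ π (σS s)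
      pres-act : ∀ b s t → Act b s t ⇔ Act (σQ b) (σS s) (σS t)
      pres-+S  : ∀ s t → σS (s +S t) ≡ σS s +S σS t
      pres-T   : ∀ n (xs ys : Fin n → S) → T n xs ys ⇔ T n (σS ∘ xs) (σS ∘ ys)

  σQ : (M → M) → M → M
  σQ f b = b

  σS : (M → M) → S → S
  σS f (a , u) = a , (u V.+ fV f a)

-- On the S-sort, σ_f is a shear (a , u) ↦ (a , u + f a) of V × V, hence bijective, additive
-- and compatible with the P-action, while Q is fixed pointwise.  The only real content is the
-- relations T_W: by the Leibniz rule the second defining sum changes under σ_f exactly by
-- f (Σ [x_i , y_i]), which vanishes on W.
module Submission where

open import Defs
open import Data.Product using (_×_; _,_; proj₁; proj₂)
open import Data.Nat using (zero; suc)
open import Data.Fin using (Fin)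
import Data.Fin as Fin
open import Function using (_∘_)
open import Function.Bundles using (_⇔_; mk⇔)
open import Function.Definitions using (Injective; Surjective)
open import Function.Construct.Identity using (bijective; ⇔-id)
open import Relation.Binary.PropositionalEquality
open import Algebra.Bundles using (AbelianGroup)
open import Algebra.Structures using (IsAbelianGroup)
import Algebra.Properties.AbelianGroup as AbelianGroupProperties
import Algebra.Properties.CommutativeSemigroup as CommutativeSemigroupProperties

module ≡-AbelianGroupProperties
  {a} {A : Set a} {_+_ : A → A → A} {0# : A} { -_ : A → A}
  (G : IsAbelianGroup _≡_ _+_ 0# -_) where

  abelianGroup : AbelianGroup a a
  abelianGroup = record { isAbelianGroup = G }

  open IsAbelianGroup G public using (identityʳ)
  open AbelianGroupProperties abelianGroup public
    using (∙-cancelʳ; identityˡ-unique; //-rightDividesˡ)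
  open CommutativeSemigroupProperties (AbelianGroup.commutativeSemigroup abelianGroup) public
    using (interchange; xy∙z≈xz∙y)

module _ {F : FiniteField} (L : TwoNilGradedLie F) where
  open TwoNilGradedLie L
  private
    module VP = ≡-AbelianGroupProperties V.isAbelianGroup
    module DP = ≡-AbelianGroupProperties D.isAbelianGroup

  infixl 6 _⊕_
  _⊕_ : M L → M L → M L
  _⊕_ = _+M_ L

  ⟨_,_⟩ : V.C → V.C → M L
  ⟨ x , y ⟩ = ⟦_,_⟧ L (ι L x) (ι L y)

  ⊕-identityʳ : ∀ m → m ⊕ 0M L ≡ m
  ⊕-identityʳ (a , x) = cong₂ _,_ (VP.identityʳ a) (DP.identityʳ x)

  ⊕-interchange : ∀ m n p r → (m ⊕ n) ⊕ (p ⊕ r) ≡ (m ⊕ p) ⊕ (n ⊕ r)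
  ⊕-interchange _ _ _ _ = cong₂ _,_ (VP.interchange _ _ _ _) (DP.interchange _ _ _ _)

  ι-+ : ∀ a b → ι L (a V.+ b) ≡ ι L a ⊕ ι L b
  ι-+ a b = cong (a V.+ b ,_) (sym (DP.identityʳ D.0v))

  ⟨⟩-+ˡ : ∀ a b c → ⟨ a V.+ b , c ⟩ ≡ ⟨ a , c ⟩ ⊕ ⟨ b , c ⟩
  ⟨⟩-+ˡ a b c = cong₂ _,_ (sym (VP.identityʳ V.0v)) (β-+ˡ a b c)

  ⟨⟩-+ʳ : ∀ a b c → ⟨ a , b V.+ c ⟩ ≡ ⟨ a , b ⟩ ⊕ ⟨ a , c ⟩
  ⟨⟩-+ʳ a b c = cong₂ _,_ (sym (VP.identityʳ V.0v)) (β-+ʳ a b c)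

  sumM-cong : ∀ n {h k : Fin n → M L} → (∀ i → h i ≡ k i) → sumM L n h ≡ sumM L n k
  sumM-cong zero    h≗k = refl
  sumM-cong (suc n) h≗k = cong₂ _⊕_ (h≗k Fin.zero) (sumM-cong n (h≗k ∘ Fin.suc))

  sumM-⊕ : ∀ n (h k : Fin n → M L) →
    sumM L n (λ i → h i ⊕ k i) ≡ sumM L n h ⊕ sumM L n k
  sumM-⊕ zero    h k = cong₂ _,_ (sym (VP.identityʳ V.0v)) (sym (DP.identityʳ D.0v))
  sumM-⊕ (suc n) h k =
    trans (cong (h Fin.zero ⊕ k Fin.zero ⊕_) (sumM-⊕ n (h ∘ Fin.suc) (k ∘ Fin.suc)))
          (⊕-interchange _ _ _ _)

  module _ {f : M L → M L} (additive : ∀ m n → f (m ⊕ n) ≡ f m ⊕ f n) where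

    additive⇒zero : f (0M L) ≡ 0M L
    additive⇒zero =
      cong₂ _,_ (VP.identityˡ-unique _ _ (cong proj₁ f0⊕f0≡f0))
                (DP.identityˡ-unique _ _ (cong proj₂ f0⊕f0≡f0))
      where
      f0⊕f0≡f0 : f (0M L) ⊕ f (0M L) ≡ f (0M L)
      f0⊕f0≡f0 = trans (sym (additive _ _)) (cong f (⊕-identityʳ (0M L)))

    additive-sumM : ∀ n (h : Fin n → M L) → f (sumM L n h) ≡ sumM L n (f ∘ h)
    additive-sumM zero    h = additive⇒zero
    additive-sumM (suc n) h =
      trans (additive _ _) (cong (f (h Fin.zero) ⊕_) (additive-sumM n (h ∘ Fin.suc)))

    fV-+ : ∀ a b → fV L f (a V.+ b) ≡ fV L f a V.+ fV L f b
    fV-+ a b = cong proj₁ (trans (cong f (ι-+ a b)) (additive _ _))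

  module _ (f : M L → M L) where
    private
      σ : S L → S L
      σ = σS L f

    σS-injective : Injective _≡_ _≡_ σ
    σS-injective {a , u} {b , v} σs≡σt with cong proj₁ σs≡σt
    ... | refl = cong (a ,_) (VP.∙-cancelʳ (fV L f a) u v (cong proj₂ σs≡σt))

    σS-surjective : Surjective _≡_ _≡_ σ
    σS-surjective (a , w) =
      (a , w V.+ V.- fV L f a) , λ { refl → cong (a ,_) (VP.//-rightDividesˡ _ w) }

    σS-action : ∀ a u b → σ (a , u V.+ b) ≡ (a , (u V.+ fV L f a) V.+ b)
    σS-action a u b = cong (a ,_) (VP.xy∙z≈xz∙y u b (fV L f a))

    σS-Act : ∀ b s t → Act L b s t ⇔ Act L b (σ s) (σ t)
    σS-Act b (a , u) t = mk⇔
      (λ { (b∈V , refl) → b∈V , σS-action a u (proj₁ b) })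
      (λ { (b∈V , σt≡) → b∈V , σS-injective (trans σt≡ (sym (σS-action a u (proj₁ b)))) })

  module _ {f : M L → M L} (d : IsGradedDerivation L f) where
    open IsGradedDerivation d using (additive; leibniz)
    private
      g : V.C → V.C
      g = fV L f

      σ : S L → S L
      σ = σS L f

    σS-+S : ∀ s t → σ (_+S_ L s t) ≡ _+S_ L (σ s) (σ t)
    σS-+S (a , u) (b , v) =
      cong (a V.+ b ,_) (trans (cong (u V.+ v V.+_) (fV-+ additive a b))
                               (VP.interchange u v (g a) (g b)))

    leibniz-shear : ∀ x u y v →
      ⟨ u V.+ g x , y ⟩ ⊕ ⟨ x , v V.+ g y ⟩ ≡ (⟨ u , y ⟩ ⊕ ⟨ x , v ⟩) ⊕ f ⟨ x , y ⟩
    leibniz-shear x u y v = begin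
      ⟨ u V.+ g x , y ⟩ ⊕ ⟨ x , v V.+ g y ⟩
        ≡⟨ cong₂ _⊕_ (⟨⟩-+ˡ u (g x) y) (⟨⟩-+ʳ x v (g y)) ⟩
      (⟨ u , y ⟩ ⊕ ⟨ g x , y ⟩) ⊕ (⟨ x , v ⟩ ⊕ ⟨ x , g y ⟩)
        ≡⟨ ⊕-interchange _ _ _ _ ⟩
      (⟨ u , y ⟩ ⊕ ⟨ x , v ⟩) ⊕ (⟨ g x , y ⟩ ⊕ ⟨ x , g y ⟩)
        -- the bracket only reads degree-one parts, so ⟦ f (ι x) , ι y ⟧ is ⟨ g x , y ⟩ on the nose
        ≡⟨ cong (⟨ u , y ⟩ ⊕ ⟨ x , v ⟩ ⊕_) (sym (leibniz (ι L x) (ι L y))) ⟩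
      (⟨ u , y ⟩ ⊕ ⟨ x , v ⟩) ⊕ f ⟨ x , y ⟩ ∎
      where open ≡-Reasoning

    σS-T : ∀ n (xs ys : Fin n → S L) → T L n xs ys ⇔ T L n (σ ∘ xs) (σ ∘ ys)
    σS-T n xs ys = mk⇔
      (λ { (w , t) → w , trans (shifted≡original w) t })
      (λ { (w , t) → w , trans (sym (shifted≡original w)) t })
      where
      brackets : Fin n → M L
      brackets i = ⟨ proj₁ (xs i) , proj₁ (ys i) ⟩

      cross : (Fin n → S L) → (Fin n → S L) → Fin n → M L
      cross ps qs i = ⟨ proj₂ (ps i) , proj₁ (qs i) ⟩ ⊕ ⟨ proj₁ (ps i) , proj₂ (qs i) ⟩

      shifted≡original : sumM L n brackets ≡ 0M L →
        sumM L n (cross (σ ∘ xs) (σ ∘ ys)) ≡ sumM L n (cross xs ys)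
      shifted≡original w = begin
        sumM L n (cross (σ ∘ xs) (σ ∘ ys))
          ≡⟨ sumM-cong n (λ i → leibniz-shear (proj₁ (xs i)) (proj₂ (xs i))
                                              (proj₁ (ys i)) (proj₂ (ys i))) ⟩
        sumM L n (λ i → cross xs ys i ⊕ f (brackets i))
          ≡⟨ sumM-⊕ n (cross xs ys) (f ∘ brackets) ⟩
        sumM L n (cross xs ys) ⊕ sumM L n (f ∘ brackets)
          ≡⟨ cong (sumM L n (cross xs ys) ⊕_) (sym (additive-sumM additive n brackets)) ⟩
        sumM L n (cross xs ys) ⊕ f (sumM L n brackets)
          ≡⟨ cong (λ m → sumM L n (cross xs ys) ⊕ f m) w ⟩
        sumM L n (cross xs ys) ⊕ f (0M L)
          ≡⟨ cong (sumM L n (cross xs ys) ⊕_) (additive⇒zero additive) ⟩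
        sumM L n (cross xs ys) ⊕ 0M L
          ≡⟨ ⊕-identityʳ _ ⟩
        sumM L n (cross xs ys) ∎
        where open ≡-Reasoning

mainTheorem14 : {F : FiniteField} (L : TwoNilGradedLie F) (f : M L → M L) →
    IsGradedDerivation L f →
    IsAutomorphismN L (σQ L f) (σS L f) × (∀ b → σQ L f b ≡ b)
mainTheorem14 L f d = automorphism , λ _ → refl
  where
  automorphism : IsAutomorphismN L (σQ L f) (σS L f)
  automorphism = record
    { bijQ     = bijective _≡_
    ; bijS     = σS-injective L f , σS-surjective L f
    ; pres-0   = refl
    ; pres-+   = λ _ _ → refl
    ; pres--   = λ _ → refl
    ; pres-·   = λ _ _ → refl
    ; pres-br  = λ _ _ → refl
    ; pres-V   = λ m → ⇔-id (InV L m)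
    ; pres-D   = λ m → ⇔-id (InD L m)
    ; pres-π   = λ _ → refl
    ; pres-act = σS-Act L f
    ; pres-+S  = σS-+S L d
    ; pres-T   = σS-T L d
    }
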